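{- Let $A$ be a set of vertices of a Johnson graph that is shattered by the edge relation, and assume $|A|\ge 4$. Then there do not exist three vertices in $A$ that are pairwise at distance $2$ from each other.
   Context: For $m\ge k$ and $|X|=m$, the Johnson graph $J(m,k)$ has vertex set $\binom{X}{k}$, two vertices adjacent iff their intersection has size $k-1$. $N(v)$ is the open neighbourhood of $v$ and distance is graph distance. A set $A$ of vertices of a graph $G$ is shattered by the edge relation if $\{A\cap N(v):v\in V(G)\}$ is the full power set of $A$. -}

module Defs where

open import Data.Nat using (ℕ; zero; suc; _<_)
open import Data.Fin using (Fin)
open import Data.Fin.Subset using (Subset; _∩_; ∣_∣; _∈_)
open import Data.Product using (Σ; ∃; _×_; proj₁)
open import Relation.Binary.PropositionalEquality using (_≡_)
open import Relation.Nullary using (¬_)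
open import Function.Bundles using (_⇔_)

JVertex : ℕ → ℕ → Set
JVertex m k = Σ (Subset m) (λ s → ∣ s ∣ ≡ k)

-- Adjacency: |u ∩ v| = k - 1 (written as 1 + |u ∩ v| = k, which is the
-- same condition and excludes the degenerate case k = 0).
JAdj : ∀ {m k} → JVertex m k → JVertex m k → Set
JAdj {m} {k} u v = suc ∣ proj₁ u ∩ proj₁ v ∣ ≡ k

data JWalk {m k : ℕ} : JVertex m k → JVertex m k → ℕ → Set where
  here : ∀ {u} → JWalk u u zero
  step : ∀ {u v w n} → JAdj u v → JWalk v w n → JWalk u w (suc n)

JDist : ∀ {m k} → JVertex m k → JVertex m k → ℕ → Set
JDist u v d = JWalk u v d × (∀ d′ → d′ < d → ¬ JWalk u v d′)

Shattered : ∀ {m k n} → (Fin n → JVertex m k) → Set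
Shattered {m} {k} {n} a =
  (S : Subset n) → ∃ λ (v : JVertex m k) → ∀ (i : Fin n) → (i ∈ S) ⇔ JAdj v (a i)

-- A vertex adjacent to two k-sets a, b at distance 2, i.e. |a ∩ b| ≤ k − 2, lies between them:
-- counting |v ∩ a| + |v ∩ b| = 2k − 2 by inclusion–exclusion forces a ∩ b ⊆ v ⊆ a ∪ b.
-- For three vertices pairwise at distance 2 the three intervals meet only in the
-- median (elementwise majority), so they have at most one common neighbour. If
-- A = {a₁,…,aₙ} is shattered, the vertices whose neighbourhoods cut out A and {a_i, a_j, a_l}
-- are both common neighbours of a_i, a_j, a_l, hence equal; so A has at most three elements.
module Submission where

open import Defs
open import Data.Nat using (ℕ; _≤_; suc; _+_; s≤s; z≤n)
open import Data.Nat.Properties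
  using (≮⇒≥; <-irrefl; <-≤-trans; +-mono-<-≤; +-mono-≤-<; +-mono-≤; +-suc;
         ≤-refl; ≤-trans; ≤-reflexive; ≤-pred; suc-injective; m≤n⇒m<n∨m≡n; ≡-irrelevant; m≤m+n; module ≤-Reasoning)
open import Data.Fin using (Fin)
open import Data.Fin.Subset using (Subset; _∩_; _∪_; ∣_∣; _∈_; _⊆_; ⊤; ⁅_⁆; inside; outside)
open import Data.Fin.Subset.Properties
  using (p∩q⊆p; p∩q⊆q; ∣p∩q∣≤∣p∣; x∈p∩q⁺; x∈p∩q⁻; x∈p∪q⁺; x∈p∪q⁻; ∩-comm; ∩-distribˡ-∪;
         ⊆-trans; ⊆-antisym; p⊆q⇒∣p∣≤∣q∣; out⊆; in⊆in; drop-∷-⊆;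
         ∈⊤; x∈⁅x⁆; ∣⁅x⁆∣≡1; ∣⊤∣≡n)
open import Data.Vec using ([]; _∷_; here)
open import Data.Product using (Σ; _×_; _,_; proj₁; proj₂)
open import Data.Sum using (inj₁; inj₂)
open import Data.Empty using (⊥-elim)
open import Relation.Binary.PropositionalEquality
  using (_≡_; refl; sym; trans; cong; cong₂; subst; module ≡-Reasoning)
open import Relation.Nullary using (¬_)
open import Function.Definitions using (Injective)
open import Function.Bundles using (_⇔_; module Equivalence)
open Equivalence using (to; from)

private
  variable
    n : ℕ

+-tight : ∀ {x y a b} → x ≤ a → y ≤ b → a + b ≤ x + y → a ≤ x × b ≤ y
+-tight x≤a y≤b a+b≤x+y =
  ≮⇒≥ (λ x<a → <-irrefl refl (<-≤-trans (+-mono-<-≤ x<a y≤b) a+b≤x+y)) ,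
  ≮⇒≥ (λ y<b → <-irrefl refl (<-≤-trans (+-mono-≤-< x≤a y<b) a+b≤x+y))

∣p∪q∣+∣p∩q∣≡∣p∣+∣q∣ : (p q : Subset n) → ∣ p ∪ q ∣ + ∣ p ∩ q ∣ ≡ ∣ p ∣ + ∣ q ∣
∣p∪q∣+∣p∩q∣≡∣p∣+∣q∣ []            []            = refl
∣p∪q∣+∣p∩q∣≡∣p∣+∣q∣ (inside  ∷ p) (inside  ∷ q) =
  cong suc (trans (+-suc _ _) (trans (cong suc (∣p∪q∣+∣p∩q∣≡∣p∣+∣q∣ p q)) (sym (+-suc _ _))))
∣p∪q∣+∣p∩q∣≡∣p∣+∣q∣ (inside  ∷ p) (outside ∷ q) = cong suc (∣p∪q∣+∣p∩q∣≡∣p∣+∣q∣ p q)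
∣p∪q∣+∣p∩q∣≡∣p∣+∣q∣ (outside ∷ p) (inside  ∷ q) =
  trans (cong suc (∣p∪q∣+∣p∩q∣≡∣p∣+∣q∣ p q)) (sym (+-suc _ _))
∣p∪q∣+∣p∩q∣≡∣p∣+∣q∣ (outside ∷ p) (outside ∷ q) = ∣p∪q∣+∣p∩q∣≡∣p∣+∣q∣ p q

∣p∪q∣≤∣p∣+∣q∣ : (p q : Subset n) → ∣ p ∪ q ∣ ≤ ∣ p ∣ + ∣ q ∣
∣p∪q∣≤∣p∣+∣q∣ p q = ≤-trans (m≤m+n _ _) (≤-reflexive (∣p∪q∣+∣p∩q∣≡∣p∣+∣q∣ p q))

p⊆q⇒∣q∣≤∣p∣⇒q⊆p : {p q : Subset n} → p ⊆ q → ∣ q ∣ ≤ ∣ p ∣ → q ⊆ p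
p⊆q⇒∣q∣≤∣p∣⇒q⊆p {p = []}          {[]}          _   _ = λ ()
p⊆q⇒∣q∣≤∣p∣⇒q⊆p {p = outside ∷ p} {outside ∷ q} p⊆q ∣q∣≤∣p∣ =
  out⊆ (p⊆q⇒∣q∣≤∣p∣⇒q⊆p (drop-∷-⊆ p⊆q) ∣q∣≤∣p∣)
p⊆q⇒∣q∣≤∣p∣⇒q⊆p {p = outside ∷ p} {inside  ∷ q} p⊆q ∣q∣<∣p∣ =
  ⊥-elim (<-irrefl refl (<-≤-trans ∣q∣<∣p∣ (p⊆q⇒∣p∣≤∣q∣ (drop-∷-⊆ p⊆q))))
p⊆q⇒∣q∣≤∣p∣⇒q⊆p {p = inside  ∷ p} {outside ∷ q} p⊆q _ with p⊆q here
... | ()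
p⊆q⇒∣q∣≤∣p∣⇒q⊆p {p = inside  ∷ p} {inside  ∷ q} p⊆q ∣q∣≤∣p∣ =
  in⊆in (p⊆q⇒∣q∣≤∣p∣⇒q⊆p (drop-∷-⊆ p⊆q) (≤-pred ∣q∣≤∣p∣))

∣p∣≤∣p∩q∣⇒p⊆q : (p q : Subset n) → ∣ p ∣ ≤ ∣ p ∩ q ∣ → p ⊆ q
∣p∣≤∣p∩q∣⇒p⊆q p q ∣p∣≤∣p∩q∣ = ⊆-trans (p⊆q⇒∣q∣≤∣p∣⇒q⊆p (p∩q⊆p p q) ∣p∣≤∣p∩q∣) (p∩q⊆q p q)

∩-mono-⊆ : {p q r s : Subset n} → p ⊆ r → q ⊆ s → p ∩ q ⊆ r ∩ s
∩-mono-⊆ {p = p} {q} p⊆r q⊆s x∈p∩q =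
  let x∈p , x∈q = x∈p∩q⁻ p q x∈p∩q in x∈p∩q⁺ (p⊆r x∈p , q⊆s x∈q)

Between : Subset n → Subset n → Subset n → Set
Between a v b = a ∩ b ⊆ v × v ⊆ a ∪ b

median : Subset n → Subset n → Subset n → Subset n
median a b c = a ∩ b ∪ b ∩ c ∪ a ∩ c

module _ {a b c v : Subset n} (v∈ab : Between a v b) (v∈bc : Between b v c) (v∈ac : Between a v c) where

  median⊆between : median a b c ⊆ v
  median⊆between x∈m with x∈p∪q⁻ (a ∩ b) _ x∈m
  ... | inj₁ x∈ab = proj₁ v∈ab x∈ab
  ... | inj₂ x∈bc∪ac with x∈p∪q⁻ (b ∩ c) _ x∈bc∪ac
  ...   | inj₁ x∈bc = proj₁ v∈bc x∈bc
  ...   | inj₂ x∈ac = proj₁ v∈ac x∈ac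

  between⊆median : v ⊆ median a b c
  between⊆median {x} x∈v with x∈p∪q⁻ a b (proj₂ v∈ab x∈v)
  ... | inj₁ x∈a with x∈p∪q⁻ b c (proj₂ v∈bc x∈v)
  ...   | inj₁ x∈b = x∈p∪q⁺ (inj₁ (x∈p∩q⁺ (x∈a , x∈b)))
  ...   | inj₂ x∈c = x∈p∪q⁺ (inj₂ (x∈p∪q⁺ (inj₂ (x∈p∩q⁺ (x∈a , x∈c)))))
  between⊆median {x} x∈v | inj₂ x∈b with x∈p∪q⁻ a c (proj₂ v∈ac x∈v)
  ...   | inj₁ x∈a = x∈p∪q⁺ (inj₁ (x∈p∩q⁺ (x∈a , x∈b)))
  ...   | inj₂ x∈c = x∈p∪q⁺ (inj₂ (x∈p∪q⁺ (inj₁ (x∈p∩q⁺ (x∈b , x∈c)))))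

  between³⇒≡median : v ≡ median a b c
  between³⇒≡median = ⊆-antisym between⊆median median⊆between

common-neighbour⇒between : ∀ {k} (v a b : Subset n) → ∣ v ∣ ≡ k →
  suc ∣ v ∩ a ∣ ≡ k → suc ∣ v ∩ b ∣ ≡ k → 2 + ∣ a ∩ b ∣ ≤ k → Between a v b
common-neighbour⇒between v a b ∣v∣≡k refl v~b 2+∣a∩b∣≤k =
  ⊆-trans (p⊆q⇒∣q∣≤∣p∣⇒q⊆p (∩-mono-⊆ (p∩q⊆q v a) (p∩q⊆q v b)) ∣a∩b∣≤∣X∩Y∣)
          (⊆-trans (p∩q⊆p X Y) (p∩q⊆p v a)) ,
  ⊆-trans (p⊆q⇒∣q∣≤∣p∣⇒q⊆p (p∩q⊆p v (a ∪ b)) ∣v∣≤∣Z∣) (p∩q⊆q v (a ∪ b))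
  where
  X Y Z : Subset _
  X = v ∩ a
  Y = v ∩ b
  Z = v ∩ (a ∪ b)

  inclusion–exclusion : ∣ Z ∣ + ∣ X ∩ Y ∣ ≡ ∣ X ∣ + ∣ X ∣
  inclusion–exclusion = begin
    ∣ Z ∣ + ∣ X ∩ Y ∣      ≡⟨ cong (λ s → ∣ s ∣ + ∣ X ∩ Y ∣) (∩-distribˡ-∪ v a b) ⟩
    ∣ X ∪ Y ∣ + ∣ X ∩ Y ∣  ≡⟨ ∣p∪q∣+∣p∩q∣≡∣p∣+∣q∣ X Y ⟩
    ∣ X ∣ + ∣ Y ∣          ≡⟨ cong (∣ X ∣ +_) (suc-injective v~b) ⟩
    ∣ X ∣ + ∣ X ∣          ∎
    where open ≡-Reasoning

  ∣v∣+∣a∩b∣≤∣Z∣+∣X∩Y∣ : ∣ v ∣ + ∣ a ∩ b ∣ ≤ ∣ Z ∣ + ∣ X ∩ Y ∣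
  ∣v∣+∣a∩b∣≤∣Z∣+∣X∩Y∣ = begin
    ∣ v ∣ + ∣ a ∩ b ∣        ≡⟨ cong (_+ ∣ a ∩ b ∣) ∣v∣≡k ⟩
    suc ∣ X ∣ + ∣ a ∩ b ∣    ≡⟨ sym (+-suc ∣ X ∣ _) ⟩
    ∣ X ∣ + suc ∣ a ∩ b ∣    ≤⟨ +-mono-≤ (≤-refl) (≤-pred 2+∣a∩b∣≤k) ⟩
    ∣ X ∣ + ∣ X ∣            ≡⟨ sym inclusion–exclusion ⟩
    ∣ Z ∣ + ∣ X ∩ Y ∣        ∎
    where open ≤-Reasoning

  tight : ∣ v ∣ ≤ ∣ Z ∣ × ∣ a ∩ b ∣ ≤ ∣ X ∩ Y ∣
  tight =
    +-tight (p⊆q⇒∣p∣≤∣q∣ (p∩q⊆p v (a ∪ b)))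
            (p⊆q⇒∣p∣≤∣q∣ (∩-mono-⊆ (p∩q⊆q v a) (p∩q⊆q v b)))
            ∣v∣+∣a∩b∣≤∣Z∣+∣X∩Y∣

  ∣v∣≤∣Z∣ : ∣ v ∣ ≤ ∣ Z ∣
  ∣v∣≤∣Z∣ = proj₁ tight

  ∣a∩b∣≤∣X∩Y∣ : ∣ a ∩ b ∣ ≤ ∣ X ∩ Y ∣
  ∣a∩b∣≤∣X∩Y∣ = proj₂ tight

∣⁅x⁆∪⁅y⁆∪⁅z⁆∣≤3 : (x y z : Fin n) → ∣ ⁅ x ⁆ ∪ ⁅ y ⁆ ∪ ⁅ z ⁆ ∣ ≤ 3
∣⁅x⁆∪⁅y⁆∪⁅z⁆∣≤3 x y z = begin
  ∣ ⁅ x ⁆ ∪ ⁅ y ⁆ ∪ ⁅ z ⁆ ∣          ≤⟨ ∣p∪q∣≤∣p∣+∣q∣ ⁅ x ⁆ _ ⟩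
  ∣ ⁅ x ⁆ ∣ + ∣ ⁅ y ⁆ ∪ ⁅ z ⁆ ∣      ≤⟨ +-mono-≤ (≤-refl) (∣p∪q∣≤∣p∣+∣q∣ ⁅ y ⁆ _) ⟩
  ∣ ⁅ x ⁆ ∣ + (∣ ⁅ y ⁆ ∣ + ∣ ⁅ z ⁆ ∣) ≡⟨ cong₂ _+_ (∣⁅x⁆∣≡1 x) (cong₂ _+_ (∣⁅x⁆∣≡1 y) (∣⁅x⁆∣≡1 z)) ⟩
  3                                  ∎
  where open ≤-Reasoning

module _ {m k : ℕ} where

  JVertex-≡ : {u w : JVertex m k} → proj₁ u ≡ proj₁ w → u ≡ w
  JVertex-≡ {s , p} {.s , q} refl = cong (s ,_) (≡-irrelevant p q)

  ∣u∩w∣≡k⇒u≡w : (u w : JVertex m k) → ∣ proj₁ u ∩ proj₁ w ∣ ≡ k → u ≡ w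
  ∣u∩w∣≡k⇒u≡w (u , ∣u∣≡k) (w , ∣w∣≡k) ∣u∩w∣≡k = JVertex-≡ (⊆-antisym u⊆w w⊆u)
    where
    u⊆w : u ⊆ w
    u⊆w = ∣p∣≤∣p∩q∣⇒p⊆q u w (≤-reflexive (trans ∣u∣≡k (sym ∣u∩w∣≡k)))

    w⊆u : w ⊆ u
    w⊆u = ∣p∣≤∣p∩q∣⇒p⊆q w u
            (≤-reflexive (trans ∣w∣≡k (sym (trans (cong ∣_∣ (∩-comm w u)) ∣u∩w∣≡k))))

  ∣u∩w∣≤k : (u w : JVertex m k) → ∣ proj₁ u ∩ proj₁ w ∣ ≤ k
  ∣u∩w∣≤k (u , ∣u∣≡k) (w , _) = subst (_ ≤_) ∣u∣≡k (∣p∩q∣≤∣p∣ u w)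

  JDist-2⇒2+∣∩∣≤k : {u w : JVertex m k} → JDist u w 2 → 2 + ∣ proj₁ u ∩ proj₁ w ∣ ≤ k
  JDist-2⇒2+∣∩∣≤k {u} {w} (_ , noShorter) with m≤n⇒m<n∨m≡n (∣u∩w∣≤k u w)
  ... | inj₂ ∣u∩w∣≡k =
    ⊥-elim (noShorter 0 (s≤s z≤n) (subst (λ x → JWalk u x 0) (∣u∩w∣≡k⇒u≡w u w ∣u∩w∣≡k) here))
  ... | inj₁ ∣u∩w∣<k with m≤n⇒m<n∨m≡n ∣u∩w∣<k
  ...   | inj₁ 2+∣u∩w∣≤k = 2+∣u∩w∣≤k
  ...   | inj₂ u~w = ⊥-elim (noShorter 1 (s≤s (s≤s z≤n)) (step u~w here))

  module _ {a b c : JVertex m k} (ab : JDist a b 2) (bc : JDist b c 2) (ac : JDist a c 2) where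

    common-neighbour≡median : {v : JVertex m k} → JAdj v a → JAdj v b → JAdj v c →
                              proj₁ v ≡ median (proj₁ a) (proj₁ b) (proj₁ c)
    common-neighbour≡median {v , ∣v∣≡k} v~a v~b v~c = between³⇒≡median
      (common-neighbour⇒between v _ _ ∣v∣≡k v~a v~b (JDist-2⇒2+∣∩∣≤k ab))
      (common-neighbour⇒between v _ _ ∣v∣≡k v~b v~c (JDist-2⇒2+∣∩∣≤k bc))
      (common-neighbour⇒between v _ _ ∣v∣≡k v~a v~c (JDist-2⇒2+∣∩∣≤k ac))

    common-neighbour-unique : {v w : JVertex m k} →
      JAdj v a → JAdj v b → JAdj v c → JAdj w a → JAdj w b → JAdj w c → v ≡ w
    common-neighbour-unique {v} {w} v~a v~b v~c w~a w~b w~c = JVertex-≡ (begin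
      proj₁ v                              ≡⟨ common-neighbour≡median {v} v~a v~b v~c ⟩
      median (proj₁ a) (proj₁ b) (proj₁ c) ≡⟨ common-neighbour≡median {w} w~a w~b w~c ⟨
      proj₁ w                              ∎)
      where open ≡-Reasoning

mainTheorem12 : (m k n : ℕ) → k ≤ m → 4 ≤ n
    → (a : Fin n → JVertex m k) → Injective _≡_ _≡_ a
    → Shattered a
    → ¬ (Σ (Fin n) λ i → Σ (Fin n) λ j → Σ (Fin n) λ l →
           JDist (a i) (a j) 2 × JDist (a j) (a l) 2 × JDist (a i) (a l) 2)
mainTheorem12 m k n _ 4≤n a _ shattered (i , j , l , ij , jl , il) = <-irrefl refl 4≤3
  where
  T : Subset n
  T = ⁅ i ⁆ ∪ ⁅ j ⁆ ∪ ⁅ l ⁆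

  vT v⊤ : JVertex m k
  vT = proj₁ (shattered T)
  v⊤ = proj₁ (shattered ⊤)

  adjT : ∀ x → x ∈ T ⇔ JAdj vT (a x)
  adjT = proj₂ (shattered T)

  adj⊤ : ∀ x → x ∈ ⊤ ⇔ JAdj v⊤ (a x)
  adj⊤ = proj₂ (shattered ⊤)

  v⊤≡vT : v⊤ ≡ vT
  v⊤≡vT = common-neighbour-unique ij jl il
    (to (adj⊤ i) ∈⊤) (to (adj⊤ j) ∈⊤) (to (adj⊤ l) ∈⊤)
    (to (adjT i) (x∈p∪q⁺ (inj₁ (x∈⁅x⁆ i))))
    (to (adjT j) (x∈p∪q⁺ (inj₂ (x∈p∪q⁺ (inj₁ (x∈⁅x⁆ j))))))
    (to (adjT l) (x∈p∪q⁺ (inj₂ (x∈p∪q⁺ (inj₂ (x∈⁅x⁆ l))))))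

  ⊤⊆T : ⊤ ⊆ T
  ⊤⊆T {x} _ = from (adjT x) (subst (λ v → JAdj v (a x)) v⊤≡vT (to (adj⊤ x) ∈⊤))

  4≤3 : 4 ≤ 3
  4≤3 = begin
    4          ≤⟨ 4≤n ⟩
    n          ≡⟨ ∣⊤∣≡n n ⟨
    ∣ ⊤ {n} ∣  ≤⟨ p⊆q⇒∣p∣≤∣q∣ ⊤⊆T ⟩
    ∣ T ∣      ≤⟨ ∣⁅x⁆∪⁅y⁆∪⁅z⁆∣≤3 i j l ⟩
    3          ∎
    where open ≤-Reasoning
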